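{- No formula in $\mathcal{L}_S$ is characteristic for some process $p$ with respect to $\equiv_S$. For $X\in\{CS,RS\}$, a formula $\varphi\in\mathcal{L}_X$ is characteristic for some process $p$ with respect to $\equiv_X$ if and only if $\varphi$ is logically equivalent to $\bigwedge_{a\in A}[a]\mathbf{ff}$.
   Context: Processes are states of finite labelled transition systems $(P,A,\to)$ with $A$ a finite nonempty action set, with the usual Hennessy–Milner semantics. Fragments: $\mathcal{L}_S$: $\varphi::=\mathbf{tt}\mid\mathbf{ff}\mid\varphi\wedge\varphi\mid\varphi\vee\varphi\mid\langle a\rangle\varphi$; $\mathcal{L}_{CS}$: $\mathcal{L}_S$ plus the constant $\mathbf{0}:=\bigwedge_{a\in A}[a]\mathbf{ff}$; $\mathcal{L}_{RS}$: $\mathcal{L}_S$ plus atomic formulae $[a]\mathbf{ff}$ ($a\in A$). For $X\in\{S,CS,RS\}$ and a process $p$, $\mathcal{L}_X(p)=\{\psi\in\mathcal{L}_X:p\models\psi\}$. A formula $\varphi\in\mathcal{L}_X$ is characteristic for $p$ with respect to (modulo) $\equiv_X$ if for every process $q$, $q\models\varphi$ iff $\mathcal{L}_X(p)=\mathcal{L}_X(q)$. Two formulae are logically equivalent if they are satisfied by exactly the same processes. -}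

module Defs where

open import Data.Nat using (ℕ; suc)
open import Data.Fin using (Fin)
open import Data.Bool using (Bool; true)
open import Data.Product using (Σ; ∃; _×_; _,_)
open import Data.Sum using (_⊎_)
open import Data.Unit using (⊤)
open import Data.Empty using (⊥)
open import Relation.Nullary using (¬_)
open import Relation.Binary.PropositionalEquality using (_≡_)
open import Function.Bundles using (_⇔_)

module _ (n : ℕ) where

  Act : Set
  Act = Fin (suc n)

  LTS : ℕ → Set
  LTS k = Fin k → Act → Fin k → Bool

  record Process : Set where
    constructor proc
    field
      size  : ℕ
      lts   : LTS size
      state : Fin size

  succP : (p : Process) → Fin (Process.size p) → Process
  succP (proc k T s) t = proc k T t

  step : (p : Process) → Act → Fin (Process.size p) → Set
  step (proc k T s) a t = T s a t ≡ true

  -- Hennessy–Milner formulae; `zero` is the constant 0 = ⋀_{a∈A} [a]ff,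
  -- `boxff a` is the atomic formula [a]ff.
  data Form : Set where
    tt ff   : Form
    _∧_ _∨_ : Form → Form → Form
    ⟨_⟩_    : Act → Form → Form
    zero    : Form
    boxff   : Act → Form

  infix 4 _⊨_
  _⊨_ : Process → Form → Set
  p ⊨ tt = ⊤
  p ⊨ ff = ⊥
  p ⊨ (φ ∧ ψ) = (p ⊨ φ) × (p ⊨ ψ)
  p ⊨ (φ ∨ ψ) = (p ⊨ φ) ⊎ (p ⊨ ψ)
  p ⊨ (⟨ a ⟩ φ) = Σ (Fin (Process.size p)) λ t → step p a t × (succP p t ⊨ φ)
  p ⊨ zero = (a : Act) (t : Fin (Process.size p)) → ¬ step p a t
  p ⊨ boxff a = (t : Fin (Process.size p)) → ¬ step p a t

  data Frag : Set where
    S CS RS : Frag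

  data In : Frag → Form → Set where
    tt    : ∀ {X} → In X tt
    ff    : ∀ {X} → In X ff
    _∧_   : ∀ {X φ ψ} → In X φ → In X ψ → In X (φ ∧ ψ)
    _∨_   : ∀ {X φ ψ} → In X φ → In X ψ → In X (φ ∨ ψ)
    ⟨_⟩_  : ∀ {X φ} a → In X φ → In X (⟨ a ⟩ φ)
    zero  : In CS zero
    boxff : ∀ a → In RS (boxff a)

  _≡[_]_ : Process → Frag → Process → Set
  p ≡[ X ] q = (ψ : Form) → In X ψ → (p ⊨ ψ) ⇔ (q ⊨ ψ)

  Characteristic : Frag → Form → Process → Set
  Characteristic X φ p = (q : Process) → (q ⊨ φ) ⇔ (p ≡[ X ] q)

  LogEquiv : Form → Form → Set
  LogEquiv φ ψ = (q : Process) → (q ⊨ φ) ⇔ (q ⊨ ψ)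

-- If p could perform some action a, take d to be the modal depth of a characteristic
-- formula φ for p. Adding to p an a-step into a state that loops on every action
-- enables no new action, so the result still satisfies φ, hence is equivalent to p,
-- and therefore p satisfies ⟨a⟩^(d+1) tt. Unfolding p into a tree of height d also
-- preserves φ, but that tree has no path of length d + 1. So characteristic formulae
-- can only characterise deadlocked processes. In L_S there are none, since every
-- satisfiable L_S formula also holds in the one-state process looping on every
-- action; in L_CS and L_RS the deadlocked processes form one class, defined by 0.
module Submission where

open import Data.Nat as ℕ using (ℕ; suc; _≤_; _⊔_; z≤n; s≤s)
open import Data.Nat.Properties using (m≤m⊔n; m≤n⊔m; ≤-trans; ≤-reflexive; 1+n≰n)
open import Data.Fin as Fin using (Fin; toℕ; fromℕ; inject₁; combine; remQuot)
open import Data.Fin.Properties using (toℕ-fromℕ; toℕ-inject₁; remQuot-combine)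
import Data.Bool as Bool
open Bool using (true; false)
open import Data.Product using (∃; _×_; _,_; proj₁; proj₂)
open import Data.Empty using (⊥-elim)
open import Data.Sum using (_⊎_; inj₁; inj₂)
open import Relation.Nullary using (¬_; Dec; yes; does)
open import Relation.Nullary.Decidable using (dec-true)
open import Relation.Binary.PropositionalEquality using (_≡_; refl; sym; cong; subst)
open import Function.Bundles using (_⇔_; mk⇔; Equivalence)
open import Function.Construct.Identity using (⇔-id)
open import Function.Construct.Symmetry using (⇔-sym)
open import Function.Construct.Composition using (_⇔-∘_)
open Equivalence using (to; from)

import Defs
open Defs hiding (_⊨_; _≡[_]_)

∧-≡-true : ∀ {x y} → x Bool.∧ y ≡ true → x ≡ true × y ≡ true
∧-≡-true {true} {true} refl = refl , refl

≡-true-∧ : ∀ {x y} → x ≡ true → y ≡ true → x Bool.∧ y ≡ true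
≡-true-∧ refl refl = refl

dec-true⁻¹ : ∀ {A : Set} (a? : Dec A) → does a? ≡ true → A
dec-true⁻¹ (yes a) _ = a

module _ (n : ℕ) where

  infix 4 _⊨_ _≡[_]_

  _⊨_ : Process n → Form n → Set
  _⊨_ = Defs._⊨_ n

  _≡[_]_ : Process n → Frag n → Process n → Set
  _≡[_]_ = Defs._≡[_]_ n

  ≡-refl : ∀ {X} p → p ≡[ X ] p
  ≡-refl p ψ _ = ⇔-id (p ⊨ ψ)

  characteristic-⊨ : ∀ {X φ p} → Characteristic n X φ p → p ⊨ φ
  characteristic-⊨ {p = p} χ = from (χ p) (≡-refl p)

  modal-depth : Form n → ℕ
  modal-depth tt        = 0
  modal-depth ff        = 0
  modal-depth (φ ∧ ψ)   = modal-depth φ ⊔ modal-depth ψ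
  modal-depth (φ ∨ ψ)   = modal-depth φ ⊔ modal-depth ψ
  modal-depth (⟨ a ⟩ φ) = suc (modal-depth φ)
  modal-depth zero      = 1
  modal-depth (boxff a) = 1

  infix 6 ⟨_⟩^_

  ⟨_⟩^_ : Act n → ℕ → Form n
  ⟨ a ⟩^ ℕ.zero = tt
  ⟨ a ⟩^ suc m  = ⟨ a ⟩ (⟨ a ⟩^ m)

  ⟨⟩^-∈ : ∀ X a m → In n X (⟨ a ⟩^ m)
  ⟨⟩^-∈ X a ℕ.zero  = tt
  ⟨⟩^-∈ X a (suc m) = ⟨ a ⟩ ⟨⟩^-∈ X a m

  deadlocked-⊭-⟨⟩ : ∀ {p a φ} → p ⊨ zero → ¬ p ⊨ ⟨ a ⟩ φ
  deadlocked-⊭-⟨⟩ p↯ (t , p-a→t , _) = p↯ _ t p-a→t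

  ⊨-deadlocked : ∀ {p q} → p ⊨ zero → q ⊨ zero → ∀ ψ → p ⊨ ψ → q ⊨ ψ
  ⊨-deadlocked p↯ q↯ tt        _             = _
  ⊨-deadlocked p↯ q↯ (φ ∧ ψ)   (p⊨φ , p⊨ψ)   = ⊨-deadlocked p↯ q↯ φ p⊨φ , ⊨-deadlocked p↯ q↯ ψ p⊨ψ
  ⊨-deadlocked p↯ q↯ (φ ∨ ψ)   (inj₁ p⊨φ)    = inj₁ (⊨-deadlocked p↯ q↯ φ p⊨φ)
  ⊨-deadlocked p↯ q↯ (φ ∨ ψ)   (inj₂ p⊨ψ)    = inj₂ (⊨-deadlocked p↯ q↯ ψ p⊨ψ)
  ⊨-deadlocked p↯ q↯ (⟨ a ⟩ φ) p⊨⟨a⟩φ        = ⊥-elim (deadlocked-⊭-⟨⟩ p↯ p⊨⟨a⟩φ)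
  ⊨-deadlocked p↯ q↯ zero      _             = q↯
  ⊨-deadlocked p↯ q↯ (boxff a) _             = q↯ a

  ≡-deadlocked : ∀ {X p q} → p ⊨ zero → q ⊨ zero → p ≡[ X ] q
  ≡-deadlocked p↯ q↯ ψ _ = mk⇔ (⊨-deadlocked p↯ q↯ ψ) (⊨-deadlocked q↯ p↯ ψ)

  ≡-preserves-zero : ∀ {X p q} → X ≡ CS ⊎ X ≡ RS → p ≡[ X ] q → p ⊨ zero → q ⊨ zero
  ≡-preserves-zero (inj₁ refl) p≡q p↯   = to (p≡q zero zero) p↯
  ≡-preserves-zero (inj₂ refl) p≡q p↯ a = to (p≡q (boxff a) (boxff a)) (p↯ a)

  ≡-deadlocked⇔ : ∀ {X p q} → X ≡ CS ⊎ X ≡ RS → p ⊨ zero → p ≡[ X ] q ⇔ q ⊨ zero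
  ≡-deadlocked⇔ X∈ p↯ = mk⇔ (λ p≡q → ≡-preserves-zero X∈ p≡q p↯) (≡-deadlocked p↯)

  characteristic-deadlocked⇔ : ∀ {X φ p} → X ≡ CS ⊎ X ≡ RS → p ⊨ zero →
                               Characteristic n X φ p ⇔ LogEquiv n φ zero
  characteristic-deadlocked⇔ X∈ p↯ = mk⇔
    (λ χ q → ≡-deadlocked⇔ X∈ p↯ ⇔-∘ χ q)
    (λ φ≈0 q → ⇔-sym (≡-deadlocked⇔ X∈ p↯) ⇔-∘ φ≈0 q)

  nil : Process n
  nil = proc 1 (λ _ _ _ → false) Fin.zero

  nil-deadlocked : nil ⊨ zero
  nil-deadlocked _ _ ()

  chaos : Process n
  chaos = proc 1 (λ _ _ _ → true) Fin.zero

  ⊨-chaos : ∀ {ψ} → In n S ψ → ∀ p → p ⊨ ψ → chaos ⊨ ψ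
  ⊨-chaos tt          p _                 = _
  ⊨-chaos (φ∈ ∧ ψ∈)   p (p⊨φ , p⊨ψ)       = ⊨-chaos φ∈ p p⊨φ , ⊨-chaos ψ∈ p p⊨ψ
  ⊨-chaos (φ∈ ∨ ψ∈)   p (inj₁ p⊨φ)        = inj₁ (⊨-chaos φ∈ p p⊨φ)
  ⊨-chaos (φ∈ ∨ ψ∈)   p (inj₂ p⊨ψ)        = inj₂ (⊨-chaos ψ∈ p p⊨ψ)
  ⊨-chaos (⟨ a ⟩ φ∈)  p (t , _ , t⊨φ)     = Fin.zero , refl , ⊨-chaos φ∈ (succP n p t) t⊨φ

  module Graft {K} (T : LTS n K) {s₀ t₀ : Fin K} {a : Act n} (s₀-a→t₀ : T s₀ a t₀ ≡ true) where

    T⁺ : LTS n (suc K)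
    T⁺ Fin.zero    _ Fin.zero    = true
    T⁺ Fin.zero    _ (Fin.suc _) = false
    T⁺ (Fin.suc s) b Fin.zero    = does (s Fin.≟ s₀) Bool.∧ does (b Fin.≟ a)
    T⁺ (Fin.suc s) b (Fin.suc t) = T s b t

    grafted : Fin K → Process n
    grafted s = proc (suc K) T⁺ (Fin.suc s)

    no-new-action : ∀ {s b} → (∀ t → ¬ T s b t ≡ true) → ¬ T⁺ (Fin.suc s) b Fin.zero ≡ true
    no-new-action {s} {b} s↛ s-b→0
      with ∧-≡-true {does (s Fin.≟ s₀)} s-b→0
    ... | s≟s₀ , b≟a with dec-true⁻¹ (s Fin.≟ s₀) s≟s₀ | dec-true⁻¹ (b Fin.≟ a) b≟a
    ... | refl | refl = s↛ t₀ s₀-a→t₀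

    ⊨-grafted : ∀ ψ {s} → proc K T s ⊨ ψ → grafted s ⊨ ψ
    ⊨-grafted tt        _                 = _
    ⊨-grafted (φ ∧ ψ)   (s⊨φ , s⊨ψ)       = ⊨-grafted φ s⊨φ , ⊨-grafted ψ s⊨ψ
    ⊨-grafted (φ ∨ ψ)   (inj₁ s⊨φ)        = inj₁ (⊨-grafted φ s⊨φ)
    ⊨-grafted (φ ∨ ψ)   (inj₂ s⊨ψ)        = inj₂ (⊨-grafted ψ s⊨ψ)
    ⊨-grafted (⟨ b ⟩ φ) (t , s-b→t , t⊨φ) = Fin.suc t , s-b→t , ⊨-grafted φ t⊨φ
    ⊨-grafted zero      s↯ b Fin.zero     = no-new-action (s↯ b)
    ⊨-grafted zero      s↯ b (Fin.suc t)  = s↯ b t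
    ⊨-grafted (boxff b) s↛ Fin.zero       = no-new-action s↛
    ⊨-grafted (boxff b) s↛ (Fin.suc t)    = s↛ t

    loop-⊨-⟨⟩^ : ∀ m → proc (suc K) T⁺ Fin.zero ⊨ ⟨ a ⟩^ m
    loop-⊨-⟨⟩^ ℕ.zero  = _
    loop-⊨-⟨⟩^ (suc m) = Fin.zero , refl , loop-⊨-⟨⟩^ m

    grafted-⊨-⟨⟩^ : ∀ m → grafted s₀ ⊨ ⟨ a ⟩^ m
    grafted-⊨-⟨⟩^ ℕ.zero  = _
    grafted-⊨-⟨⟩^ (suc m) =
      Fin.zero , ≡-true-∧ (dec-true (s₀ Fin.≟ s₀) refl) (dec-true (a Fin.≟ a) refl) , loop-⊨-⟨⟩^ m

  -- State combine s r is a copy of s that may still perform toℕ r steps.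
  module Unfold {K} (T : LTS n K) (d : ℕ) where

    origin : Fin (K ℕ.* suc d) → Fin K
    origin x = proj₁ (remQuot {K} (suc d) x)

    budget : Fin (K ℕ.* suc d) → Fin (suc d)
    budget x = proj₂ (remQuot {K} (suc d) x)

    origin-combine : ∀ s r → origin (combine s r) ≡ s
    origin-combine s r = cong proj₁ (remQuot-combine {K} {suc d} s r)

    budget-combine : ∀ s r → budget (combine s r) ≡ r
    budget-combine s r = cong proj₂ (remQuot-combine {K} {suc d} s r)

    T↓ : LTS n (K ℕ.* suc d)
    T↓ x b y = T (origin x) b (origin y) Bool.∧ does (toℕ (budget x) ℕ.≟ suc (toℕ (budget y)))

    unfolded : Fin K → Fin (suc d) → Process n
    unfolded s r = proc (K ℕ.* suc d) T↓ (combine s r)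

    unfolded-step : ∀ {s b t r r′} → T s b t ≡ true → toℕ r ≡ suc (toℕ r′) →
                    T↓ (combine s r) b (combine t r′) ≡ true
    unfolded-step {s} {b} {t} {r} {r′} s-b→t r≡1+r′
      rewrite origin-combine s r | origin-combine t r′ | budget-combine s r | budget-combine t r′ =
      ≡-true-∧ s-b→t (dec-true (toℕ r ℕ.≟ suc (toℕ r′)) r≡1+r′)

    unfolded-step⁻¹ : ∀ {s b r y} → T↓ (combine s r) b y ≡ true → T s b (origin y) ≡ true
    unfolded-step⁻¹ {s} {b} {r} {y} x-b→y with ∧-≡-true {T (origin (combine s r)) b (origin y)} x-b→y
    ... | s-b→y , _ rewrite origin-combine s r = s-b→y

    ⊨-unfolded : ∀ ψ {s r} → modal-depth ψ ≤ toℕ r → proc K T s ⊨ ψ → unfolded s r ⊨ ψ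
    ⊨-unfolded tt        _  _           = _
    ⊨-unfolded (φ ∧ ψ)   ≤r (s⊨φ , s⊨ψ) =
      ⊨-unfolded φ (≤-trans (m≤m⊔n _ _) ≤r) s⊨φ , ⊨-unfolded ψ (≤-trans (m≤n⊔m _ _) ≤r) s⊨ψ
    ⊨-unfolded (φ ∨ ψ)   ≤r (inj₁ s⊨φ)  = inj₁ (⊨-unfolded φ (≤-trans (m≤m⊔n _ _) ≤r) s⊨φ)
    ⊨-unfolded (φ ∨ ψ)   ≤r (inj₂ s⊨ψ)  = inj₂ (⊨-unfolded ψ (≤-trans (m≤n⊔m _ _) ≤r) s⊨ψ)
    ⊨-unfolded (⟨ b ⟩ φ) {r = Fin.suc r} (s≤s ≤r) (t , s-b→t , t⊨φ) =
      combine t (inject₁ r) ,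
      unfolded-step s-b→t (cong suc (sym (toℕ-inject₁ r))) ,
      ⊨-unfolded φ (subst (modal-depth φ ≤_) (sym (toℕ-inject₁ r)) ≤r) t⊨φ
    ⊨-unfolded zero      _  s↯ b y x-b→y = s↯ b (origin y) (unfolded-step⁻¹ x-b→y)
    ⊨-unfolded (boxff b) _  s↛ y x-b→y   = s↛ (origin y) (unfolded-step⁻¹ x-b→y)

    ⟨⟩^-≤-budget : ∀ {a} m x → proc (K ℕ.* suc d) T↓ x ⊨ ⟨ a ⟩^ m → m ≤ toℕ (budget x)
    ⟨⟩^-≤-budget ℕ.zero  x _ = z≤n
    ⟨⟩^-≤-budget {a} (suc m) x (y , x-a→y , y⊨) =
      subst (suc m ≤_) (sym budget-decreases) (s≤s (⟨⟩^-≤-budget m y y⊨))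
      where
      budget-decreases : toℕ (budget x) ≡ suc (toℕ (budget y))
      budget-decreases = dec-true⁻¹ (toℕ (budget x) ℕ.≟ suc (toℕ (budget y)))
                                    (proj₂ (∧-≡-true {T (origin x) a (origin y)} x-a→y))

  characteristic⇒deadlocked : ∀ {X φ p} → Characteristic n X φ p → p ⊨ zero
  characteristic⇒deadlocked {X} {φ} {proc K T s₀} χ a t₀ s₀-a→t₀ =
    1+n≰n (subst (suc d ≤_) budget≡d (⟨⟩^-≤-budget (suc d) (combine s₀ (fromℕ d)) unfolded⊨ψ))
    where
    open Graft T s₀-a→t₀
    d = modal-depth φ
    open Unfold T d
    ψ = ⟨ a ⟩^ suc d
    ψ∈X = ⟨⟩^-∈ X a (suc d)
    p⊨φ = characteristic-⊨ χ
    p⊨ψ : proc K T s₀ ⊨ ψ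
    p⊨ψ = from (to (χ (grafted s₀)) (⊨-grafted φ p⊨φ) ψ ψ∈X) (grafted-⊨-⟨⟩^ (suc d))
    unfolded⊨φ : unfolded s₀ (fromℕ d) ⊨ φ
    unfolded⊨φ = ⊨-unfolded φ (≤-reflexive (sym (toℕ-fromℕ d))) p⊨φ
    unfolded⊨ψ : unfolded s₀ (fromℕ d) ⊨ ψ
    unfolded⊨ψ = to (to (χ (unfolded s₀ (fromℕ d))) unfolded⊨φ ψ ψ∈X) p⊨ψ
    budget≡d : toℕ (budget (combine s₀ (fromℕ d))) ≡ d
    budget≡d rewrite budget-combine s₀ (fromℕ d) = toℕ-fromℕ d

  no-characteristic-S : (φ : Form n) → In n S φ → ¬ ∃ (λ p → Characteristic n S φ p)
  no-characteristic-S φ φ∈S (p , χ) = deadlocked-⊭-⟨⟩ {p} (characteristic⇒deadlocked χ) p⊨⟨0⟩tt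
    where
    chaos⊨φ : chaos ⊨ φ
    chaos⊨φ = ⊨-chaos φ∈S p (characteristic-⊨ χ)
    p⊨⟨0⟩tt : p ⊨ ⟨ Fin.zero ⟩ tt
    p⊨⟨0⟩tt = from (to (χ chaos) chaos⊨φ (⟨ Fin.zero ⟩ tt) (⟨ Fin.zero ⟩ tt)) (Fin.zero , refl , _)

  characteristic⇔zero : (X : Frag n) → X ≡ CS ⊎ X ≡ RS → (φ : Form n) → In n X φ →
                        ∃ (λ p → Characteristic n X φ p) ⇔ LogEquiv n φ zero
  characteristic⇔zero X X∈ φ _ = mk⇔
    (λ (p , χ) → to (characteristic-deadlocked⇔ X∈ (characteristic⇒deadlocked χ)) χ)
    (λ φ≈0 → nil , from (characteristic-deadlocked⇔ X∈ nil-deadlocked) φ≈0)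

proposition36 : (n : ℕ)
    → ((φ : Form n) → In n S φ → ¬ ∃ (λ p → Characteristic n S φ p))
      × ((X : Frag n) → (X ≡ CS ⊎ X ≡ RS) → (φ : Form n) → In n X φ
          → (∃ (λ p → Characteristic n X φ p) ⇔ LogEquiv n φ (zero {n})))
proposition36 n = no-characteristic-S n , characteristic⇔zero n
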